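{- Let $\mathcal{M}$ be a countable $\mathcal L$-structure with $\mathcal{M}\models\mathrm{MOST}+\Delta_0^{\mathcal P}\text{ -collection}$, let $I\subseteq M$ be an $H$-cut of $\mathcal M$, and let $\mathcal I=\langle I,\in^{\mathcal M}\rangle$. Then the class of $\mathcal M$-cardinals in $\mathrm{Ord}^{\mathcal M}\setminus\mathrm{Ord}^{\mathcal I}$ has no least element.
   Context: $\mathcal{L}$ is the language with one binary relation $\in$; for $a\in M$, $a^*=\{x\in M:\mathcal M\models x\in a\}$. $\mathrm{Mac}$: extensionality, pairing, emptyset, union, infinity, powerset, transitive containment, $\Delta_0$-separation, set foundation, and "every set can be well-ordered". $\mathrm{MOST}=\mathrm{Mac}+\Sigma_1$-separation$+\Delta_0$-collection. $\Delta_0^{\mathcal P}$-collection is the collection scheme restricted to formulae built from atomic formulae using connectives and bounded quantifiers $\exists x\in y,\forall x\in y,\exists x\subseteq y,\forall x\subseteq y$. For $\mathcal{L}$-structures $\mathcal{A}\subseteq\mathcal{B}$: end-extension means members (in $\mathcal B$) of elements of $A$ lie in $A$; powerset-preserving means additionally every $x\in B$ with $\mathcal B\models x\subseteq y$ for some $y\in A$ lies in $A$; topless means end-extension, $A\ne B$, and every $C\in B$ with $C^*\subseteq\mathrm{Ord}^{\mathcal A}$ lies in $A$. For $\mathcal M\models\mathrm{MOST}$, $I\subseteq M$ is an $H$-cut if $\mathcal M$ is a topless powerset-preserving end-extension of the substructure $\langle I,\in^{\mathcal M}\rangle$ and $\langle I,\in^{\mathcal M}\rangle\models\mathrm{MOST}$.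 -}

module Defs where

open import Data.Nat using (ℕ; zero; suc)
open import Data.Product using (Σ; ∃; _×_; _,_; proj₁)
open import Data.Sum using (_⊎_)
open import Data.Empty using (⊥)
open import Relation.Nullary using (¬_)
open import Relation.Binary.PropositionalEquality using (_≡_)

record Str : Set₁ where
  field
    M    : Set
    _∈_  : M → M → Set

-- Formulas of L (with equality), de Bruijn indices for variables.
data Fm : Set where
  _∈'_ : ℕ → ℕ → Fm
  _≐_  : ℕ → ℕ → Fm
  ⊥'   : Fm
  _⇒_  : Fm → Fm → Fm
  _∧'_ : Fm → Fm → Fm
  _∨'_ : Fm → Fm → Fm
  ∀'   : Fm → Fm
  ∃'   : Fm → Fm

Sub : ℕ → ℕ → Fm
Sub a b = ∀' ((0 ∈' suc a) ⇒ (0 ∈' suc b))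

data IsΔ0 : Fm → Set where
  at∈ : ∀ i j → IsΔ0 (i ∈' j)
  at≐ : ∀ i j → IsΔ0 (i ≐ j)
  bot : IsΔ0 ⊥'
  imp : ∀ {φ ψ} → IsΔ0 φ → IsΔ0 ψ → IsΔ0 (φ ⇒ ψ)
  cnj : ∀ {φ ψ} → IsΔ0 φ → IsΔ0 ψ → IsΔ0 (φ ∧' ψ)
  dsj : ∀ {φ ψ} → IsΔ0 φ → IsΔ0 ψ → IsΔ0 (φ ∨' ψ)
  b∀  : ∀ {φ} y → IsΔ0 φ → IsΔ0 (∀' ((0 ∈' suc y) ⇒ φ))
  b∃  : ∀ {φ} y → IsΔ0 φ → IsΔ0 (∃' ((0 ∈' suc y) ∧' φ))

data IsΔ0P : Fm → Set where
  at∈ : ∀ i j → IsΔ0P (i ∈' j)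
  at≐ : ∀ i j → IsΔ0P (i ≐ j)
  bot : IsΔ0P ⊥'
  imp : ∀ {φ ψ} → IsΔ0P φ → IsΔ0P ψ → IsΔ0P (φ ⇒ ψ)
  cnj : ∀ {φ ψ} → IsΔ0P φ → IsΔ0P ψ → IsΔ0P (φ ∧' ψ)
  dsj : ∀ {φ ψ} → IsΔ0P φ → IsΔ0P ψ → IsΔ0P (φ ∨' ψ)
  b∀  : ∀ {φ} y → IsΔ0P φ → IsΔ0P (∀' ((0 ∈' suc y) ⇒ φ))
  b∃  : ∀ {φ} y → IsΔ0P φ → IsΔ0P (∃' ((0 ∈' suc y) ∧' φ))
  s∀  : ∀ {φ} y → IsΔ0P φ → IsΔ0P (∀' (Sub 0 (suc y) ⇒ φ))
  s∃  : ∀ {φ} y → IsΔ0P φ → IsΔ0P (∃' (Sub 0 (suc y) ∧' φ))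

data IsΣ1 : Fm → Set where
  δ0 : ∀ {φ} → IsΔ0 φ → IsΣ1 φ
  ex : ∀ {φ} → IsΣ1 φ → IsΣ1 (∃' φ)

module _ (𝓜 : Str) where
  open Str 𝓜

  Env : Set
  Env = ℕ → M

  _∷ₑ_ : M → Env → Env
  (x ∷ₑ ρ) zero    = x
  (x ∷ₑ ρ) (suc n) = ρ n

  -- Tarskian satisfaction (classical under the excluded-middle hypothesis)
  Sat : Env → Fm → Set
  Sat ρ (i ∈' j) = ρ i ∈ ρ j
  Sat ρ (i ≐ j)  = ρ i ≡ ρ j
  Sat ρ ⊥'       = ⊥
  Sat ρ (φ ⇒ ψ)  = Sat ρ φ → Sat ρ ψ
  Sat ρ (φ ∧' ψ) = Sat ρ φ × Sat ρ ψ
  Sat ρ (φ ∨' ψ) = Sat ρ φ ⊎ Sat ρ ψ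
  Sat ρ (∀' φ)   = (x : M) → Sat (x ∷ₑ ρ) φ
  Sat ρ (∃' φ)   = Σ M λ x → Sat (x ∷ₑ ρ) φ

  _⊆_ : M → M → Set
  a ⊆ b = ∀ x → x ∈ a → x ∈ b

  Transitive : M → Set
  Transitive a = ∀ x → x ∈ a → x ⊆ a

  IsOrd : M → Set
  IsOrd a = Transitive a × (∀ x → x ∈ a → Transitive x)

  -- p is the Kuratowski pair ⟨x , y⟩ = {{x},{x,y}}
  IsPair : M → M → M → Set
  IsPair p x y = ∀ z → (z ∈ p → (∀ w → (w ∈ z → (w ≡ x ⊎ w ≡ y)) × (w ≡ x → w ∈ z))
                               × ((∀ w → w ∈ z → w ≡ x) ⊎ (y ∈ z)))
                     × ((∀ w → w ∈ z → w ≡ x) × x ∈ z → z ∈ p)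
                     × ((∀ w → w ∈ z → (w ≡ x ⊎ w ≡ y)) × x ∈ z × y ∈ z → z ∈ p)

  Rel : M → M → M → Set
  Rel r x y = Σ M λ p → p ∈ r × IsPair p x y

  WellOrders : M → M → Set
  WellOrders r a =
      (∀ x → x ∈ a → ¬ Rel r x x)
    × (∀ x y z → x ∈ a → y ∈ a → z ∈ a → Rel r x y → Rel r y z → Rel r x z)
    × (∀ x y → x ∈ a → y ∈ a → Rel r x y ⊎ x ≡ y ⊎ Rel r y x)
    × (∀ s → s ⊆ a → (Σ M λ x → x ∈ s) →
         Σ M λ m → m ∈ s × (∀ x → x ∈ s → ¬ Rel r x m))

  IsBij : M → M → M → Set
  IsBij f a b =
      (∀ p → p ∈ f → Σ M λ x → Σ M λ y → x ∈ a × y ∈ b × IsPair p x y)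
    × (∀ x → x ∈ a → Σ M λ y → y ∈ b × Rel f x y)
    × (∀ x y y' → Rel f x y → Rel f x y' → y ≡ y')
    × (∀ x x' y → Rel f x y → Rel f x' y → x ≡ x')
    × (∀ y → y ∈ b → Σ M λ x → x ∈ a × Rel f x y)

  IsCard : M → Set
  IsCard κ = IsOrd κ × (∀ α → α ∈ κ → ¬ (Σ M λ f → IsBij f α κ))

  -- Axioms (written out as what "𝓜 ⊨ axiom" unfolds to)

  Extensionality : Set
  Extensionality = ∀ a b → (∀ x → (x ∈ a → x ∈ b) × (x ∈ b → x ∈ a)) → a ≡ b

  Pairing : Set
  Pairing = ∀ a b → Σ M λ c → a ∈ c × b ∈ c

  Emptyset : Set
  Emptyset = Σ M λ e → ∀ x → ¬ (x ∈ e)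

  Union : Set
  Union = ∀ a → Σ M λ u → ∀ y → (y ∈ u → Σ M λ x → x ∈ a × y ∈ x)
                                × ((Σ M λ x → x ∈ a × y ∈ x) → y ∈ u)

  Infinity : Set
  Infinity = Σ M λ w → (Σ M λ e → e ∈ w × (∀ x → ¬ (x ∈ e)))
                     × (∀ x → x ∈ w → Σ M λ y → y ∈ w
                          × (∀ z → (z ∈ y → (z ∈ x ⊎ z ≡ x)) × ((z ∈ x ⊎ z ≡ x) → z ∈ y)))

  Powerset : Set
  Powerset = ∀ a → Σ M λ p → ∀ x → (x ∈ p → x ⊆ a) × (x ⊆ a → x ∈ p)

  TransitiveContainment : Set
  TransitiveContainment = ∀ a → Σ M λ t → a ⊆ t × Transitive t

  SetFoundation : Set
  SetFoundation = ∀ a → (Σ M λ x → x ∈ a) → Σ M λ x → x ∈ a × (∀ y → y ∈ x → ¬ (y ∈ a))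

  WellOrdering : Set
  WellOrdering = ∀ a → Σ M λ r → WellOrders r a

  -- separation instance for φ: variable 0 of φ is x, variables ≥ 1 are parameters
  SeparationFor : Fm → Set
  SeparationFor φ = ∀ (ρ : Env) a → Σ M λ b → ∀ x →
      (x ∈ b → x ∈ a × Sat (x ∷ₑ ρ) φ) × (x ∈ a × Sat (x ∷ₑ ρ) φ → x ∈ b)

  -- collection instance for φ: variable 0 is y, variable 1 is x, rest parameters
  CollectionFor : Fm → Set
  CollectionFor φ = ∀ (ρ : Env) a →
      (∀ x → x ∈ a → Σ M λ y → Sat (y ∷ₑ (x ∷ₑ ρ)) φ) →
      Σ M λ b → ∀ x → x ∈ a → Σ M λ y → y ∈ b × Sat (y ∷ₑ (x ∷ₑ ρ)) φ

  record ⊨Mac : Set where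
    field
      ext   : Extensionality
      pair  : Pairing
      empty : Emptyset
      union : Union
      inf   : Infinity
      pow   : Powerset
      tc    : TransitiveContainment
      Δ0sep : ∀ φ → IsΔ0 φ → SeparationFor φ
      found : SetFoundation
      wo    : WellOrdering

  record ⊨MOST : Set where
    field
      mac   : ⊨Mac
      Σ1sep : ∀ φ → IsΣ1 φ → SeparationFor φ
      Δ0col : ∀ φ → IsΔ0 φ → CollectionFor φ

  Δ0P-Collection : Set
  Δ0P-Collection = ∀ φ → IsΔ0P φ → CollectionFor φ

  Countable : Set
  Countable = Σ (ℕ → M) λ f → ∀ x → Σ ℕ λ n → f n ≡ x

module _ (𝓜 : Str) where
  open Str 𝓜

  Substr : (M → Set) → Str
  Substr I = record { M = Σ M I ; _∈_ = λ x y → proj₁ x ∈ proj₁ y }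

  OrdOf : (I : M → Set) → M → Set
  OrdOf I x = Σ (I x) λ ix → IsOrd (Substr I) (x , ix)

  EndExt : (M → Set) → Set
  EndExt I = ∀ a x → I a → x ∈ a → I x

  PowersetPreserving : (M → Set) → Set
  PowersetPreserving I = EndExt I × (∀ x y → I y → _⊆_ 𝓜 x y → I x)

  Topless : (M → Set) → Set
  Topless I = EndExt I
            × (Σ M λ b → ¬ I b)
            × (∀ C → (∀ x → x ∈ C → OrdOf I x) → I C)

  record HCut (I : M → Set) : Set where
    field
      topless  : Topless I
      pp       : PowersetPreserving I
      ⊨MOST-I  : ⊨MOST (Substr I)

-- Suppose κ is least. By toplessness some α ∈ κ lies outside the cut, and by minimality of κ
-- its 𝓜-cardinality k < κ lies inside, together with a bijection f : k ≅ α in 𝓜. Pulling ∈ back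
-- along f gives a well-order R of k, which lies in I by powerset-preservation. In I, Σ1-separation
-- collects the set G of those t ∈ k at which the Mostowski collapse of (k , R) is defined; in 𝓜 that
-- collapse is f, so f[G] is a set of ordinals of I and hence lies in I by toplessness. An ∈-induction
-- on α using powerset-preservation gives α ⊆ f[G], so α ∈ I after all.
module Submission where

open import Defs
open import Axiom.ExcludedMiddle using (ExcludedMiddle)
open import Axiom.DoubleNegationElimination using (DoubleNegationElimination; em⇒dne)
open import Level using (0ℓ)
open import Data.Nat using (ℕ; zero; suc; _+_)
open import Data.Product using (Σ; _×_; _,_; proj₁; proj₂)
import Data.Product
open import Data.Sum using (_⊎_; inj₁; inj₂; [_,_]′; reduce)
import Data.Sum as Sum
open import Function using (id; _∘_; const)
open import Relation.Nullary using (¬_)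
open import Relation.Binary.PropositionalEquality using (_≡_; refl; sym; trans; subst; subst₂; cong)

All∈ : ℕ → Fm → Fm
All∈ y φ = ∀' ((0 ∈' suc y) ⇒ φ)

Ex∈ : ℕ → Fm → Fm
Ex∈ y φ = ∃' ((0 ∈' suc y) ∧' φ)

SingletonF : ℕ → ℕ → Fm
SingletonF z x = All∈ z (0 ≐ suc x) ∧' (x ∈' z)

DoubletonF : ℕ → ℕ → ℕ → Fm
DoubletonF z x y = All∈ z ((0 ≐ suc x) ∨' (0 ≐ suc y)) ∧' ((x ∈' z) ∧' (y ∈' z))

PairF : ℕ → ℕ → ℕ → Fm
PairF p x y = All∈ p (SingletonF 0 (suc x) ∨' DoubletonF 0 (suc x) (suc y))
  ∧' (Ex∈ p (SingletonF 0 (suc x)) ∧' Ex∈ p (DoubletonF 0 (suc x) (suc y)))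

RelF : ℕ → ℕ → ℕ → Fm
RelF r x y = Ex∈ r (PairF 0 (suc x) (suc y))

BijF : ℕ → ℕ → ℕ → Fm
BijF f a b =
  All∈ f (Ex∈ (suc a) (Ex∈ (suc (suc b)) (PairF 2 1 0)))
  ∧' (All∈ a (Ex∈ (suc b) (RelF (2 + f) 1 0))
  ∧' (All∈ a (All∈ (suc b) (All∈ (2 + b) (RelF (3 + f) 2 1 ⇒ (RelF (3 + f) 2 0 ⇒ (1 ≐ 0)))))
  ∧' (All∈ a (All∈ (suc a) (All∈ (2 + b) (RelF (3 + f) 2 0 ⇒ (RelF (3 + f) 1 0 ⇒ (2 ≐ 1)))))
  ∧' All∈ b (Ex∈ (suc a) (RelF (2 + f) 0 1)))))

ImageBelowF : ℕ → ℕ → ℕ → ℕ → ℕ → Fm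
ImageBelowF g x u A R =
  All∈ u (Ex∈ (suc A) (RelF (2 + R) 0 (2 + x) ∧' RelF (2 + g) 0 1))
  ∧' All∈ A (RelF (1 + R) 0 (1 + x) ⇒ Ex∈ (1 + g) (Ex∈ 0 (Ex∈ 0 (PairF 2 3 0 ∧' (0 ∈' (4 + u))))))

PartialCollapseF : ℕ → ℕ → ℕ → ℕ → Fm
PartialCollapseF g a A R =
  All∈ g (Ex∈ (1 + A) (Ex∈ 1 (Ex∈ 0 (PairF 3 2 0 ∧' (RelF (4 + R) 2 (4 + a) ∧' ImageBelowF (4 + g) 2 0 (4 + A) (4 + R))))))
  ∧' All∈ A (RelF (1 + R) 0 (1 + a) ⇒ Ex∈ (1 + g) (Ex∈ 0 (Ex∈ 0 (PairF 2 3 0))))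

SingletonF-Δ0 : ∀ z x → IsΔ0 (SingletonF z x)
SingletonF-Δ0 z x = cnj (b∀ z (at≐ _ _)) (at∈ _ _)

DoubletonF-Δ0 : ∀ z x y → IsΔ0 (DoubletonF z x y)
DoubletonF-Δ0 z x y = cnj (b∀ z (dsj (at≐ _ _) (at≐ _ _))) (cnj (at∈ _ _) (at∈ _ _))

PairF-Δ0 : ∀ p x y → IsΔ0 (PairF p x y)
PairF-Δ0 p x y = cnj (b∀ p (dsj (SingletonF-Δ0 _ _) (DoubletonF-Δ0 _ _ _)))
  (cnj (b∃ p (SingletonF-Δ0 _ _)) (b∃ p (DoubletonF-Δ0 _ _ _)))

RelF-Δ0 : ∀ r x y → IsΔ0 (RelF r x y)
RelF-Δ0 r x y = b∃ r (PairF-Δ0 _ _ _)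

BijF-Δ0 : ∀ f a b → IsΔ0 (BijF f a b)
BijF-Δ0 f a b = cnj (b∀ f (b∃ _ (b∃ _ (PairF-Δ0 _ _ _))))
  (cnj (b∀ a (b∃ _ (RelF-Δ0 _ _ _)))
  (cnj (b∀ a (b∀ _ (b∀ _ (imp (RelF-Δ0 _ _ _) (imp (RelF-Δ0 _ _ _) (at≐ _ _))))))
  (cnj (b∀ a (b∀ _ (b∀ _ (imp (RelF-Δ0 _ _ _) (imp (RelF-Δ0 _ _ _) (at≐ _ _))))))
  (b∀ b (b∃ _ (RelF-Δ0 _ _ _))))))

ImageBelowF-Δ0 : ∀ g x u A R → IsΔ0 (ImageBelowF g x u A R)
ImageBelowF-Δ0 g x u A R = cnj (b∀ u (b∃ _ (cnj (RelF-Δ0 _ _ _) (RelF-Δ0 _ _ _))))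
  (b∀ A (imp (RelF-Δ0 _ _ _) (b∃ _ (b∃ 0 (b∃ 0 (cnj (PairF-Δ0 _ _ _) (at∈ _ _)))))))

PartialCollapseF-Δ0 : ∀ g a A R → IsΔ0 (PartialCollapseF g a A R)
PartialCollapseF-Δ0 g a A R =
  cnj (b∀ g (b∃ _ (b∃ 1 (b∃ 0 (cnj (PairF-Δ0 _ _ _) (cnj (RelF-Δ0 _ _ _) (ImageBelowF-Δ0 _ _ _ _ _)))))))
      (b∀ A (imp (RelF-Δ0 _ _ _) (b∃ _ (b∃ 0 (b∃ 0 (PairF-Δ0 _ _ _))))))

-- Sat unfolds definitionally on SingletonF, DoubletonF, PairF, RelF, BijF, ImageBelowF and
-- PartialCollapseF to the predicates below, which is how separation for those formulas is read.
module Δ0Notions (𝓜 : Str) where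
  open Str 𝓜

  Singleton : M → M → Set
  Singleton z x = (∀ w → w ∈ z → w ≡ x) × x ∈ z

  Doubleton : M → M → M → Set
  Doubleton z x y = (∀ w → w ∈ z → w ≡ x ⊎ w ≡ y) × (x ∈ z × y ∈ z)

  IsPair₀ : M → M → M → Set
  IsPair₀ p x y = (∀ z → z ∈ p → Singleton z x ⊎ Doubleton z x y)
    × ((Σ M λ z → z ∈ p × Singleton z x) × (Σ M λ z → z ∈ p × Doubleton z x y))

  Rel₀ : M → M → M → Set
  Rel₀ r x y = Σ M λ p → p ∈ r × IsPair₀ p x y

  IsBij₀ : M → M → M → Set
  IsBij₀ f a b =
      (∀ p → p ∈ f → Σ M λ x → x ∈ a × (Σ M λ y → y ∈ b × IsPair₀ p x y))
    × ((∀ x → x ∈ a → Σ M λ y → y ∈ b × Rel₀ f x y)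
    × ((∀ x → x ∈ a → ∀ y → y ∈ b → ∀ y' → y' ∈ b → Rel₀ f x y → Rel₀ f x y' → y ≡ y')
    × ((∀ x → x ∈ a → ∀ x' → x' ∈ a → ∀ y → y ∈ b → Rel₀ f x y → Rel₀ f x' y → x ≡ x')
    × (∀ y → y ∈ b → Σ M λ x → x ∈ a × Rel₀ f x y))))

  IsImageBelow : M → M → M → M → M → Set
  IsImageBelow g x u A R =
      (∀ w → w ∈ u → Σ M λ y → y ∈ A × (Rel₀ R y x × Rel₀ g y w))
    × (∀ y → y ∈ A → Rel₀ R y x →
         Σ M λ p → p ∈ g × (Σ M λ q → q ∈ p × (Σ M λ w → w ∈ q × (IsPair₀ p y w × w ∈ u))))

  -- g is defined exactly on the R-predecessors of a and satisfies the
  -- Mostowski-collapse recursion g x = { g y ∣ y R x } there.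
  PartialCollapse : M → M → M → M → Set
  PartialCollapse g a A R =
      (∀ p → p ∈ g → Σ M λ x → x ∈ A × (Σ M λ q → q ∈ p × (Σ M λ u → u ∈ q ×
         (IsPair₀ p x u × (Rel₀ R x a × IsImageBelow g x u A R)))))
    × (∀ x → x ∈ A → Rel₀ R x a →
         Σ M λ p → p ∈ g × (Σ M λ q → q ∈ p × (Σ M λ u → u ∈ q × IsPair₀ p x u)))

  IsPair₀-right : ∀ {p x y} → IsPair₀ p x y → Σ M λ q → q ∈ p × y ∈ q
  IsPair₀-right (_ , _ , (d , d∈p , (_ , _ , y∈d))) = d , d∈p , y∈d

  pair-elements : ∀ {p x y} → IsPair₀ p x y → ∀ s → s ∈ p → ∀ t → t ∈ s → t ≡ x ⊎ t ≡ y
  pair-elements (shape , _) s s∈p t t∈s = [ (λ sng → inj₁ (proj₁ sng t t∈s)) , (λ dbl → proj₁ dbl t t∈s) ]′ (shape s s∈p)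

module Elementary (𝓜 : Str) (dne : DoubleNegationElimination 0ℓ) (mac : ⊨Mac 𝓜) where
  open Str 𝓜
  open Δ0Notions 𝓜
  open ⊨Mac mac using (ext; pow; Δ0sep; found) renaming (pair to pairing)

  infixr 5 _∷_
  _∷_ : M → Env 𝓜 → Env 𝓜
  _∷_ = _∷ₑ_ 𝓜

  ordinal-element : ∀ {α x} → IsOrd 𝓜 α → x ∈ α → IsOrd 𝓜 x
  ordinal-element ord-α x∈α = proj₂ ord-α _ x∈α , λ z z∈x → proj₂ ord-α z (proj₁ ord-α _ x∈α z z∈x)

  doubleton : ∀ x y → Σ M λ d → Doubleton d x y
  doubleton x y with pairing x y
  ... | c , x∈c , y∈c with Δ0sep ((0 ≐ 1) ∨' (0 ≐ 2)) (dsj (at≐ 0 1) (at≐ 0 2)) (x ∷ y ∷ const x) c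
  ... | d , d-spec = d , (λ w w∈d → proj₂ (proj₁ (d-spec w) w∈d))
                       , proj₂ (d-spec x) (x∈c , inj₁ refl) , proj₂ (d-spec y) (y∈c , inj₂ refl)

  singleton : ∀ x → Σ M λ s → Singleton s x
  singleton x with doubleton x x
  ... | s , s⊆x , x∈s , _ = s , (λ w w∈s → reduce (s⊆x w w∈s)) , x∈s

  IsPair⇒IsPair₀ : ∀ {p x y} → IsPair 𝓜 p x y → IsPair₀ p x y
  IsPair⇒IsPair₀ {p} {x} {y} P =
    shape , (s , proj₁ (proj₂ (P s)) s-sng , s-sng) , (d , proj₂ (proj₂ (P d)) d-dbl , d-dbl)
    where
    s : M
    s = proj₁ (singleton x)
    s-sng : Singleton s x
    s-sng = proj₂ (singleton x)
    d : M
    d = proj₁ (doubleton x y)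
    d-dbl : Doubleton d x y
    d-dbl = proj₂ (doubleton x y)
    shape : ∀ z → z ∈ p → Singleton z x ⊎ Doubleton z x y
    shape z z∈p with proj₁ (P z) z∈p
    ... | z-spec , inj₁ z⊆x = inj₁ (z⊆x , proj₂ (z-spec x) refl)
    ... | z-spec , inj₂ y∈z = inj₂ ((λ w w∈z → proj₁ (z-spec w) w∈z) , proj₂ (z-spec x) refl , y∈z)

  pair : ∀ x y → Σ M λ p → IsPair₀ p x y
  pair x y with singleton x | doubleton x y
  ... | s , s-sng | d , d-dbl with doubleton s d
  ... | p , p⊆sd , s∈p , d∈p = p , shape , (s , s∈p , s-sng) , (d , d∈p , d-dbl)
    where
    shape : ∀ z → z ∈ p → Singleton z x ⊎ Doubleton z x y
    shape z z∈p with p⊆sd z z∈p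
    ... | inj₁ refl = inj₁ s-sng
    ... | inj₂ refl = inj₂ d-dbl

  pair-injective : ∀ {p x y x' y'} → IsPair₀ p x y → IsPair₀ p x' y' → x ≡ x' × y ≡ y'
  pair-injective {_} {x} {y} {x'} {y'} (shape , (s , s∈p , s-sng) , (d , d∈p , d-dbl)) (shape' , _ , (d' , d'∈p , d'-dbl)) =
    x≡x' , y≡y'
    where
    x≡x' : x ≡ x'
    x≡x' = [ (λ sng → sym (proj₁ s-sng _ (proj₂ sng))) , (λ dbl → sym (proj₁ s-sng _ (proj₁ (proj₂ dbl)))) ]′
             (shape' s s∈p)
    y∈x'y' : y ≡ x' ⊎ y ≡ y'
    y∈x'y' = [ (λ sng → inj₁ (proj₁ sng _ (proj₂ (proj₂ d-dbl)))) , (λ dbl → proj₁ dbl _ (proj₂ (proj₂ d-dbl))) ]′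
               (shape' d d∈p)
    y'∈xy : y' ≡ x ⊎ y' ≡ y
    y'∈xy = [ (λ sng → inj₁ (proj₁ sng _ (proj₂ (proj₂ d'-dbl)))) , (λ dbl → proj₁ dbl _ (proj₂ (proj₂ d'-dbl))) ]′
              (shape d' d'∈p)
    y≡y' : y ≡ y'
    y≡y' = [ (λ y≡x' → [ (λ y'≡x → trans y≡x' (trans (sym x≡x') (sym y'≡x))) , sym ]′ y'∈xy) , id ]′ y∈x'y'

  ∈-irrefl : ∀ x → ¬ (x ∈ x)
  ∈-irrefl x x∈x with singleton x
  ... | s , s-sng with found s (x , proj₂ s-sng)
  ... | y , y∈s , y-min with proj₁ s-sng y y∈s
  ... | refl = y-min y x∈x y∈s

  IsBij⇒IsBij₀ : ∀ {f a b} → IsBij 𝓜 f a b → IsBij₀ f a b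
  IsBij⇒IsBij₀ {f} {a} {b} (graph , total , functional , injective , surjective) =
      (λ p p∈f → let (x , y , x∈a , y∈b , P) = graph p p∈f in x , x∈a , y , y∈b , IsPair⇒IsPair₀ P)
    , (λ x x∈a → let (y , y∈b , fxy) = total x x∈a in y , y∈b , to₀ fxy)
    , (λ x _ y _ y' _ fxy fxy' → functional x y y' (from₀ fxy) (from₀ fxy'))
    , (λ x _ x' _ y _ fxy fx'y → injective x x' y (from₀ fxy) (from₀ fx'y))
    , (λ y y∈b → let (x , x∈a , fxy) = surjective y y∈b in x , x∈a , to₀ fxy)
    where
    to₀ : ∀ {x y} → Rel 𝓜 f x y → Rel₀ f x y
    to₀ (p , p∈f , P) = p , p∈f , IsPair⇒IsPair₀ P
    from₀ : ∀ {x y} → Rel₀ f x y → Rel 𝓜 f x y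
    from₀ (p , p∈f , P₀) with graph p p∈f
    ... | _ , _ , _ , _ , P with pair-injective P₀ (IsPair⇒IsPair₀ P)
    ... | refl , refl = p , p∈f , P

  module Bij₀ {f a b} (f-bij : IsBij₀ f a b) where
    rel-∈ : ∀ {x y} → Rel₀ f x y → x ∈ a × y ∈ b
    rel-∈ (p , p∈f , P) with proj₁ f-bij p p∈f
    ... | _ , x∈a , _ , y∈b , P' with pair-injective P P'
    ... | refl , refl = x∈a , y∈b

    total : ∀ x → x ∈ a → Σ M λ y → y ∈ b × Rel₀ f x y
    total = proj₁ (proj₂ f-bij)

    functional : ∀ {x y y'} → Rel₀ f x y → Rel₀ f x y' → y ≡ y'
    functional fxy fxy' =
      proj₁ (proj₂ (proj₂ f-bij)) _ (proj₁ (rel-∈ fxy)) _ (proj₂ (rel-∈ fxy)) _ (proj₂ (rel-∈ fxy')) fxy fxy'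

    injective : ∀ {x x' y} → Rel₀ f x y → Rel₀ f x' y → x ≡ x'
    injective fxy fx'y =
      proj₁ (proj₂ (proj₂ (proj₂ f-bij))) _ (proj₁ (rel-∈ fxy)) _ (proj₁ (rel-∈ fx'y)) _ (proj₂ (rel-∈ fxy)) fxy fx'y

    surjective : ∀ y → y ∈ b → Σ M λ x → x ∈ a × Rel₀ f x y
    surjective = proj₂ (proj₂ (proj₂ (proj₂ f-bij)))

  -- γ ⊆ α makes P(P(α)) a bound for the graph of the composite.
  composite : ∀ g f {γ k α} → _⊆_ 𝓜 γ α → Σ M λ h →
      (∀ p → p ∈ h → Σ M λ x → x ∈ γ × (Σ M λ z → z ∈ α × IsPair₀ p x z))
    × ((∀ {x y z} → x ∈ γ → y ∈ k → z ∈ α → Rel₀ g x y → Rel₀ f y z → Rel₀ h x z)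
    × (∀ {x z} → Rel₀ h x z → Σ M λ y → y ∈ k × (Rel₀ g x y × Rel₀ f y z)))
  composite g f {γ} {k} {α} γ⊆α = proj₁ H , graph , intro , elim
    where
    PPα : M
    PPα = proj₁ (pow (proj₁ (pow α)))
    pair∈PPα : ∀ {p x z} → x ∈ α → z ∈ α → IsPair₀ p x z → p ∈ PPα
    pair∈PPα {p} x∈α z∈α P = proj₂ (proj₂ (pow (proj₁ (pow α))) p) λ s s∈p → proj₂ (proj₂ (pow α) s) λ t t∈s →
      [ (λ { refl → x∈α }) , (λ { refl → z∈α }) ]′ (pair-elements P s s∈p t t∈s)
    Through : M → M → Set
    Through x z = Σ M λ y → y ∈ k × (Rel₀ g x y × Rel₀ f y z)
    H : Σ M λ h → ∀ p → (p ∈ h → p ∈ PPα × (Σ M λ x → x ∈ γ × (Σ M λ z → z ∈ α × (IsPair₀ p x z × Through x z))))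
                      × (p ∈ PPα × (Σ M λ x → x ∈ γ × (Σ M λ z → z ∈ α × (IsPair₀ p x z × Through x z))) → p ∈ h)
    H = Δ0sep (Ex∈ 1 (Ex∈ 3 (PairF 2 1 0 ∧' Ex∈ 5 (RelF 7 2 0 ∧' RelF 8 0 1))))
              (b∃ 1 (b∃ 3 (cnj (PairF-Δ0 _ _ _) (b∃ 5 (cnj (RelF-Δ0 _ _ _) (RelF-Δ0 _ _ _))))))
              (γ ∷ α ∷ k ∷ g ∷ f ∷ const f) PPα
    graph : ∀ p → p ∈ proj₁ H → Σ M λ x → x ∈ γ × (Σ M λ z → z ∈ α × IsPair₀ p x z)
    graph p p∈h = let (_ , x , x∈γ , z , z∈α , P , _) = proj₁ (proj₂ H p) p∈h in x , x∈γ , z , z∈α , P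
    intro : ∀ {x y z} → x ∈ γ → y ∈ k → z ∈ α → Rel₀ g x y → Rel₀ f y z → Rel₀ (proj₁ H) x z
    intro {x} {y} {z} x∈γ y∈k z∈α gxy fyz =
      let (p , P) = pair x z
      in p , proj₂ (proj₂ H p) (pair∈PPα (γ⊆α x x∈γ) z∈α P , x , x∈γ , z , z∈α , P , y , y∈k , gxy , fyz) , P
    elim : ∀ {x z} → Rel₀ (proj₁ H) x z → Through x z
    elim (p , p∈h , P) with proj₁ (proj₂ H p) p∈h
    ... | _ , _ , _ , _ , _ , P' , through with pair-injective P P'
    ... | refl , refl = through

  IsBij₀-∘ : ∀ {g f γ k α} → IsBij₀ g γ k → IsBij₀ f k α → _⊆_ 𝓜 γ α → Σ M λ h → IsBij₀ h γ α
  IsBij₀-∘ {g} {f} {γ} {k} {α} g-bij f-bij γ⊆α with composite g f γ⊆α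
  ... | h , graph , intro , elim = h , graph , total , functional , injective , surjective
    where
    module G = Bij₀ g-bij
    module F = Bij₀ f-bij
    total : ∀ x → x ∈ γ → Σ M λ z → z ∈ α × Rel₀ h x z
    total x x∈γ =
      let (y , y∈k , gxy) = G.total x x∈γ ; (z , z∈α , fyz) = F.total y y∈k
      in z , z∈α , intro x∈γ y∈k z∈α gxy fyz
    functional : ∀ x → x ∈ γ → ∀ z → z ∈ α → ∀ z' → z' ∈ α → Rel₀ h x z → Rel₀ h x z' → z ≡ z'
    functional _ _ _ _ _ _ hxz hxz' =
      let (_ , _ , gxy , fyz) = elim hxz ; (_ , _ , gxy' , fy'z') = elim hxz'
      in F.functional fyz (subst (λ y → Rel₀ f y _) (sym (G.functional gxy gxy')) fy'z')
    injective : ∀ x → x ∈ γ → ∀ x' → x' ∈ γ → ∀ z → z ∈ α → Rel₀ h x z → Rel₀ h x' z → x ≡ x'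
    injective _ _ _ _ _ _ hxz hx'z =
      let (_ , _ , gxy , fyz) = elim hxz ; (_ , _ , gx'y' , fy'z) = elim hx'z
      in G.injective gxy (subst (Rel₀ g _) (sym (F.injective fyz fy'z)) gx'y')
    surjective : ∀ z → z ∈ α → Σ M λ x → x ∈ γ × Rel₀ h x z
    surjective z z∈α =
      let (y , y∈k , fyz) = F.surjective z z∈α ; (x , x∈γ , gxy) = G.surjective y y∈k
      in x , x∈γ , intro x∈γ y∈k z∈α gxy fyz

  ∈-induction : ∀ (P : M → Set) {α D} → Transitive 𝓜 α →
    (∀ z → z ∈ D → z ∈ α × ¬ P z) → (∀ z → z ∈ α → ¬ P z → z ∈ D) →
    (∀ z → z ∈ α → (∀ v → v ∈ z → P v) → P z) → ∀ z → z ∈ α → P z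
  ∈-induction P {α} {D} trans-α D-sound D-complete step z z∈α = dne λ ¬Pz → minimal-refuted (found D (z , D-complete z z∈α ¬Pz))
    where
    minimal-refuted : ¬ (Σ M λ m → m ∈ D × (∀ v → v ∈ m → ¬ v ∈ D))
    minimal-refuted (m , m∈D , m-min) with D-sound m m∈D
    ... | m∈α , ¬Pm = ¬Pm (step m m∈α λ v v∈m → dne λ ¬Pv → m-min v v∈m (D-complete v (trans-α m m∈α v v∈m) ¬Pv))

  module _ (Σ1sep : ∀ φ → IsΣ1 φ → SeparationFor 𝓜 φ) where

    cardinality : ∀ {α} → IsOrd 𝓜 α → ¬ IsCard 𝓜 α → Σ M λ k → k ∈ α × (IsCard 𝓜 k × (Σ M λ f → IsBij₀ f k α))
    cardinality {α} ord-α not-card = k , k∈α , (ordinal-element ord-α k∈α , not-smaller) , f , f-bij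
      where
      S : Σ M λ S → ∀ β → (β ∈ S → β ∈ α × (Σ M λ f → IsBij₀ f β α)) × (β ∈ α × (Σ M λ f → IsBij₀ f β α) → β ∈ S)
      S = Σ1sep (∃' (BijF 0 1 2)) (ex (δ0 (BijF-Δ0 0 1 2))) (α ∷ const α) α
      smaller : Σ M λ β → β ∈ α × (Σ M λ g → IsBij 𝓜 g β α)
      smaller = dne λ none → not-card (ord-α , λ β β∈α bij → none (β , β∈α , bij))
      least : Σ M λ k → k ∈ proj₁ S × (∀ γ → γ ∈ k → ¬ γ ∈ proj₁ S)
      least = let (β , β∈α , g , g-bij) = smaller
              in found (proj₁ S) (β , proj₂ (proj₂ S β) (β∈α , g , IsBij⇒IsBij₀ g-bij))
      k : M
      k = proj₁ least
      k∈S : k ∈ proj₁ S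
      k∈S = proj₁ (proj₂ least)
      k∈α : k ∈ α
      k∈α = proj₁ (proj₁ (proj₂ S k) k∈S)
      f : M
      f = proj₁ (proj₂ (proj₁ (proj₂ S k) k∈S))
      f-bij : IsBij₀ f k α
      f-bij = proj₂ (proj₂ (proj₁ (proj₂ S k) k∈S))
      not-smaller : ∀ γ → γ ∈ k → ¬ (Σ M λ g → IsBij 𝓜 g γ k)
      not-smaller γ γ∈k (g , g-bij) =
        proj₂ (proj₂ least) γ γ∈k (proj₂ (proj₂ S γ) (γ∈α , IsBij₀-∘ (IsBij⇒IsBij₀ g-bij) f-bij (proj₁ ord-α γ γ∈α)))
        where
        γ∈α : γ ∈ α
        γ∈α = proj₁ ord-α k k∈α γ γ∈k

  -- Uniqueness of the Mostowski collapse of (A , R), where R is the pull-back of ∈ along f : A ≅ α.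
  module Collapse {A α f R} (f-bij : IsBij₀ f A α) (ord-α : IsOrd 𝓜 α)
    (R⇒∈ : ∀ {y x} → Rel₀ R y x → y ∈ A × (x ∈ A × (∀ u u' → Rel₀ f y u → Rel₀ f x u' → u ∈ u')))
    (∈⇒R : ∀ {y x u u'} → y ∈ A → x ∈ A → Rel₀ f y u → Rel₀ f x u' → u ∈ u' → Rel₀ R y x) where
    open Bij₀ f-bij

    R-trans : ∀ {y x a} → Rel₀ R y x → Rel₀ R x a → Rel₀ R y a
    R-trans Ryx Rxa with R⇒∈ Ryx | R⇒∈ Rxa
    ... | y∈A , x∈A , fy∈fx | _ , a∈A , fx∈fa with total _ y∈A | total _ x∈A | total _ a∈A
    ... | u , _ , fyu | u' , _ , fxu' | u'' , u''∈α , fau'' =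
      ∈⇒R y∈A a∈A fyu fau'' (proj₂ ord-α u'' u''∈α u' (fx∈fa u' u'' fxu' fau'') u (fy∈fx u u' fyu fxu'))

    f-from-image-below : ∀ {g x u} → x ∈ A → IsImageBelow g x u A R →
      (∀ y w → Rel₀ R y x → Rel₀ g y w → Rel₀ f y w) → Rel₀ f x u
    f-from-image-below {g} {x} {u} x∈A (u⊆img , img⊆u) g⊆f with total x x∈A
    ... | u₀ , u₀∈α , fxu₀ = subst (Rel₀ f x) (sym (ext u u₀ λ w → u⊆u₀ w , u₀⊆u w)) fxu₀
      where
      u⊆u₀ : ∀ w → w ∈ u → w ∈ u₀
      u⊆u₀ w w∈u with u⊆img w w∈u
      ... | y , _ , Ryx , gyw = proj₂ (proj₂ (R⇒∈ Ryx)) w u₀ (g⊆f y w Ryx gyw) fxu₀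
      u₀⊆u : ∀ w → w ∈ u₀ → w ∈ u
      u₀⊆u w w∈u₀ with surjective w (proj₁ ord-α u₀ u₀∈α w w∈u₀)
      ... | y , y∈A , fyw with img⊆u y y∈A (∈⇒R y∈A x∈A fyw fxu₀ w∈u₀)
      ... | p , p∈g , _ , _ , w' , _ , P , w'∈u with functional fyw (g⊆f y w' (∈⇒R y∈A x∈A fyw fxu₀ w∈u₀) (p , p∈g , P))
      ... | refl = w'∈u

    module Agreement (g : M) where
      Agrees : M → Set
      Agrees z = ∀ y w → Rel₀ f y z → Rel₀ g y w → w ≡ z

      Disagreement : M → M → Set
      Disagreement y z = Σ M λ p → p ∈ g × (Σ M λ q → q ∈ p × (Σ M λ w → w ∈ q × (IsPair₀ p y w × ¬ w ≡ z)))

      disagreements : Σ M λ D → ∀ z → (z ∈ D → z ∈ α × (Σ M λ y → y ∈ A × (Rel₀ f y z × Disagreement y z)))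
                                    × (z ∈ α × (Σ M λ y → y ∈ A × (Rel₀ f y z × Disagreement y z)) → z ∈ D)
      disagreements = Δ0sep (Ex∈ 1 (RelF 3 0 1 ∧' Ex∈ 4 (Ex∈ 0 (Ex∈ 0 (PairF 2 3 0 ∧' ((0 ≐ 4) ⇒ ⊥'))))))
                            (b∃ 1 (cnj (RelF-Δ0 _ _ _) (b∃ 4 (b∃ 0 (b∃ 0 (cnj (PairF-Δ0 _ _ _) (imp (at≐ _ _) bot)))))))
                            (A ∷ f ∷ g ∷ const g) α

      disagreements-sound : ∀ z → z ∈ proj₁ disagreements → z ∈ α × ¬ Agrees z
      disagreements-sound z z∈D with proj₁ (proj₂ disagreements z) z∈D
      ... | z∈α , y , _ , fyz , p , p∈g , _ , _ , w , _ , P , w≢z = z∈α , λ ag → w≢z (ag y w fyz (p , p∈g , P))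

      disagreements-complete : ∀ z → z ∈ α → ¬ Agrees z → z ∈ proj₁ disagreements
      disagreements-complete z z∈α disagrees = dne λ z∉D → disagrees λ y w fyz → λ { (p , p∈g , P) → dne λ w≢z →
        let (q , q∈p , w∈q) = IsPair₀-right P
        in z∉D (proj₂ (proj₂ disagreements z) (z∈α , y , proj₁ (rel-∈ fyz) , fyz , p , p∈g , q , q∈p , w , w∈q , P , w≢z)) }

    partial-collapse⊆f : ∀ {g a} → PartialCollapse g a A R → ∀ {y w} → Rel₀ g y w → Rel₀ f y w
    partial-collapse⊆f {g} {a} (g-graph , _) {y} {w} gyw =
      let (z , z∈α , fyz) = total y (proj₁ (g-dom gyw)) in subst (Rel₀ f y) (sym (agrees z z∈α y w fyz gyw)) fyz
      where
      open Agreement g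
      g-dom : ∀ {y w} → Rel₀ g y w → y ∈ A × IsImageBelow g y w A R
      g-dom (p , p∈g , P) with g-graph p p∈g
      ... | _ , y∈A , _ , _ , _ , _ , P' , _ , img with pair-injective P P'
      ... | refl , refl = y∈A , img
      step : ∀ z → z ∈ α → (∀ v → v ∈ z → Agrees v) → Agrees z
      step z _ below y w fyz gyw = functional (f-from-image-below y∈A img g⊆f) fyz
        where
        y∈A : y ∈ A
        y∈A = proj₁ (g-dom gyw)
        img : IsImageBelow g y w A R
        img = proj₂ (g-dom gyw)
        g⊆f : ∀ y' w' → Rel₀ R y' y → Rel₀ g y' w' → Rel₀ f y' w'
        g⊆f y' w' Ry'y gy'w' with total y' (proj₁ (R⇒∈ Ry'y))
        ... | v , _ , fy'v = subst (Rel₀ f y') (sym (below v (proj₂ (proj₂ (R⇒∈ Ry'y)) v z fy'v fyz) y' w' fy'v gy'w')) fy'v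
      agrees : ∀ z → z ∈ α → Agrees z
      agrees = ∈-induction Agrees (proj₁ ord-α) disagreements-sound disagreements-complete step

    collapse-unique : ∀ {g a v} → a ∈ A → PartialCollapse g a A R → IsImageBelow g a v A R → Rel₀ f a v
    collapse-unique a∈A g-coll img = f-from-image-below a∈A img λ _ _ _ → partial-collapse⊆f g-coll

    module Restriction (a : M) where
      RestrictedPair : M → Set
      RestrictedPair p = Σ M λ x → x ∈ A × (Σ M λ q → q ∈ p × (Σ M λ u → u ∈ q × (IsPair₀ p x u × Rel₀ R x a)))

      f↾a-set : Σ M λ g → ∀ p → (p ∈ g → p ∈ f × RestrictedPair p) × (p ∈ f × RestrictedPair p → p ∈ g)
      f↾a-set = Δ0sep (Ex∈ 1 (Ex∈ 1 (Ex∈ 0 (PairF 3 2 0 ∧' RelF 5 2 6))))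
                      (b∃ 1 (b∃ 1 (b∃ 0 (cnj (PairF-Δ0 _ _ _) (RelF-Δ0 _ _ _)))))
                      (A ∷ R ∷ a ∷ const a) f

      f↾a : M
      f↾a = proj₁ f↾a-set

      f↾a-elim : ∀ p → p ∈ f↾a → p ∈ f × RestrictedPair p
      f↾a-elim p = proj₁ (proj₂ f↾a-set p)

      f↾a-intro : ∀ {p x u} → p ∈ f → x ∈ A → IsPair₀ p x u → Rel₀ R x a → p ∈ f↾a
      f↾a-intro {p} p∈f x∈A P Rxa =
        let (q , q∈p , u∈q) = IsPair₀-right P in proj₂ (proj₂ f↾a-set p) (p∈f , _ , x∈A , q , q∈p , _ , u∈q , P , Rxa)

      f↾a-image : ∀ x u → x ∈ A → (∀ {y} → Rel₀ R y x → Rel₀ R y a) → Rel₀ f x u → IsImageBelow f↾a x u A R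
      f↾a-image x u x∈A below-a fxu = u⊆img , img⊆u
        where
        u⊆img : ∀ t → t ∈ u → Σ M λ y → y ∈ A × (Rel₀ R y x × Rel₀ f↾a y t)
        u⊆img t t∈u with surjective t (proj₁ ord-α u (proj₂ (rel-∈ fxu)) t t∈u)
        ... | y , y∈A , (p , p∈f , P) =
          let Ryx = ∈⇒R y∈A x∈A (p , p∈f , P) fxu t∈u in y , y∈A , Ryx , p , f↾a-intro p∈f y∈A P (below-a Ryx) , P
        img⊆u : ∀ y → y ∈ A → Rel₀ R y x →
          Σ M λ p → p ∈ f↾a × (Σ M λ q → q ∈ p × (Σ M λ t → t ∈ q × (IsPair₀ p y t × t ∈ u)))
        img⊆u y y∈A Ryx with total y y∈A
        ... | t , _ , (p , p∈f , P) =
          let (q , q∈p , t∈q) = IsPair₀-right P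
          in p , f↾a-intro p∈f y∈A P (below-a Ryx) , q , q∈p , t , t∈q , P , proj₂ (proj₂ (R⇒∈ Ryx)) t u (p , p∈f , P) fxu

      f↾a-collapse : PartialCollapse f↾a a A R
      f↾a-collapse = graph , defined
        where
        graph : ∀ p → p ∈ f↾a → Σ M λ x → x ∈ A × (Σ M λ q → q ∈ p × (Σ M λ u → u ∈ q
                  × (IsPair₀ p x u × (Rel₀ R x a × IsImageBelow f↾a x u A R))))
        graph p p∈f↾a with f↾a-elim p p∈f↾a
        ... | p∈f , x , x∈A , q , q∈p , u , u∈q , P , Rxa =
          x , x∈A , q , q∈p , u , u∈q , P , Rxa , f↾a-image x u x∈A (λ Ryx → R-trans Ryx Rxa) (p , p∈f , P)
        defined : ∀ x → x ∈ A → Rel₀ R x a → Σ M λ p → p ∈ f↾a × (Σ M λ q → q ∈ p × (Σ M λ u → u ∈ q × IsPair₀ p x u))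
        defined x x∈A Rxa with total x x∈A
        ... | u , _ , (p , p∈f , P) =
          let (q , q∈p , u∈q) = IsPair₀-right P in p , f↾a-intro p∈f x∈A P Rxa , q , q∈p , u , u∈q , P

      f↾a-bounded : ∀ {w} → Rel₀ f a w → ∀ p → p ∈ f↾a → Σ M λ x → Σ M λ u → IsPair₀ p x u × (x ∈ A × u ∈ w)
      f↾a-bounded {w} faw p p∈f↾a with f↾a-elim p p∈f↾a
      ... | p∈f , x , x∈A , _ , _ , u , _ , P , Rxa = x , u , P , x∈A , proj₂ (proj₂ (R⇒∈ Rxa)) u w (p , p∈f , P) faw

    restriction-below : ∀ {a w} → a ∈ A → Rel₀ f a w →
      Σ M λ g → PartialCollapse g a A R × (IsImageBelow g a w A R
        × (∀ p → p ∈ g → Σ M λ x → Σ M λ u → IsPair₀ p x u × (x ∈ A × u ∈ w)))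
    restriction-below {a} {w} a∈A faw = f↾a , f↾a-collapse , f↾a-image a w a∈A id faw , f↾a-bounded faw
      where open Restriction a

module Absoluteness (𝓜 : Str) (I : Str.M 𝓜 → Set) (end-ext : EndExt 𝓜 I) (extI : Extensionality (Substr 𝓜 I)) where
  open Str 𝓜

  N : Str
  N = Substr 𝓜 I

  Agree : Env N → Env 𝓜 → Set
  Agree ρ σ = ∀ n → proj₁ (ρ n) ≡ σ n

  Agree-∷ : ∀ {ρ σ} x → Agree ρ σ → Agree (_∷ₑ_ N x ρ) (_∷ₑ_ 𝓜 (proj₁ x) σ)
  Agree-∷ x ag zero = refl
  Agree-∷ x ag (suc n) = ag n

  ∈-pull : ∀ ρ σ → Agree ρ σ → ∀ y {x} → x ∈ σ y → x ∈ proj₁ (ρ y)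
  ∈-pull ρ σ ag y = subst (_ ∈_) (sym (ag y))

  in-cut : ∀ ρ σ → Agree ρ σ → ∀ y {x} → x ∈ σ y → I x
  in-cut ρ σ ag y x∈σy = end-ext _ _ (proj₂ (ρ y)) (∈-pull ρ σ ag y x∈σy)

  proj₁-injective : {x y : Σ M I} → proj₁ x ≡ proj₁ y → x ≡ y
  proj₁-injective {x} {y} e = extI x y λ z → subst (proj₁ z ∈_) e , subst (proj₁ z ∈_) (sym e)

  Δ0-absolute′ : ∀ {φ} → IsΔ0 φ → ∀ {ρ σ} → Agree ρ σ → (Sat N ρ φ → Sat 𝓜 σ φ) × (Sat 𝓜 σ φ → Sat N ρ φ)
  Δ0-absolute′ (at∈ i j) ag = subst₂ _∈_ (ag i) (ag j) , subst₂ _∈_ (sym (ag i)) (sym (ag j))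
  Δ0-absolute′ (at≐ i j) ag =
    (λ e → trans (sym (ag i)) (trans (cong proj₁ e) (ag j))) , λ e → proj₁-injective (trans (ag i) (trans e (sym (ag j))))
  Δ0-absolute′ bot ag = id , id
  Δ0-absolute′ (imp φ ψ) ag =
    (λ h → proj₁ (Δ0-absolute′ ψ ag) ∘ h ∘ proj₂ (Δ0-absolute′ φ ag)) ,
    (λ h → proj₂ (Δ0-absolute′ ψ ag) ∘ h ∘ proj₁ (Δ0-absolute′ φ ag))
  Δ0-absolute′ (cnj φ ψ) ag =
    Data.Product.map (proj₁ (Δ0-absolute′ φ ag)) (proj₁ (Δ0-absolute′ ψ ag)) ,
    Data.Product.map (proj₂ (Δ0-absolute′ φ ag)) (proj₂ (Δ0-absolute′ ψ ag))
  Δ0-absolute′ (dsj φ ψ) ag =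
    Sum.map (proj₁ (Δ0-absolute′ φ ag)) (proj₁ (Δ0-absolute′ ψ ag)) ,
    Sum.map (proj₂ (Δ0-absolute′ φ ag)) (proj₂ (Δ0-absolute′ ψ ag))
  Δ0-absolute′ (b∀ y φ) {ρ} {σ} ag =
    (λ h x x∈σy → proj₁ (Δ0-absolute′ φ (Agree-∷ (x , in-cut ρ σ ag y x∈σy) ag)) (h (x , in-cut ρ σ ag y x∈σy) (∈-pull ρ σ ag y x∈σy))) ,
    (λ h x x∈ρy → proj₂ (Δ0-absolute′ φ (Agree-∷ x ag)) (h (proj₁ x) (subst (proj₁ x ∈_) (ag y) x∈ρy)))
  Δ0-absolute′ (b∃ y φ) {ρ} {σ} ag =
    (λ { (x , x∈ρy , s) → proj₁ x , subst (proj₁ x ∈_) (ag y) x∈ρy , proj₁ (Δ0-absolute′ φ (Agree-∷ x ag)) s }) ,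
    (λ { (x , x∈σy , s) → (x , in-cut ρ σ ag y x∈σy) , ∈-pull ρ σ ag y x∈σy
                        , proj₂ (Δ0-absolute′ φ (Agree-∷ (x , in-cut ρ σ ag y x∈σy) ag)) s })

  Δ0-absolute : ∀ {φ} → IsΔ0 φ → ∀ ρ → (Sat N ρ φ → Sat 𝓜 (proj₁ ∘ ρ) φ) × (Sat 𝓜 (proj₁ ∘ ρ) φ → Sat N ρ φ)
  Δ0-absolute φ-Δ0 ρ = Δ0-absolute′ φ-Δ0 λ _ → refl

  Σ1-upward′ : ∀ {φ} → IsΣ1 φ → ∀ {ρ σ} → Agree ρ σ → Sat N ρ φ → Sat 𝓜 σ φ
  Σ1-upward′ (δ0 φ-Δ0) ag = proj₁ (Δ0-absolute′ φ-Δ0 ag)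
  Σ1-upward′ (ex φ-Σ1) ag (x , s) = proj₁ x , Σ1-upward′ φ-Σ1 (Agree-∷ x ag) s

  Σ1-upward : ∀ {φ} → IsΣ1 φ → ∀ ρ → Sat N ρ φ → Sat 𝓜 (proj₁ ∘ ρ) φ
  Σ1-upward φ-Σ1 ρ = Σ1-upward′ φ-Σ1 λ _ → refl

module Cut (𝓜 : Str) (dne : DoubleNegationElimination 0ℓ) (mac : ⊨Mac 𝓜) (I : Str.M 𝓜 → Set) (hcut : HCut 𝓜 I) where
  open Str 𝓜
  open Δ0Notions 𝓜
  open Elementary 𝓜 dne mac
  open ⊨Mac mac using (Δ0sep)
  open ⊨MOST (HCut.⊨MOST-I hcut) using () renaming (mac to macI; Σ1sep to Σ1sepI)
  open ⊨Mac macI using () renaming (ext to extI; pair to pairI; union to unionI; pow to powI)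

  end-ext : EndExt 𝓜 I
  end-ext = proj₁ (HCut.topless hcut)

  ordinals-in-cut : ∀ C → (∀ x → x ∈ C → OrdOf 𝓜 I x) → I C
  ordinals-in-cut = proj₂ (proj₂ (HCut.topless hcut))

  ⊆-in-cut : ∀ x y → I y → _⊆_ 𝓜 x y → I x
  ⊆-in-cut = proj₂ (HCut.pp hcut)

  open Absoluteness 𝓜 I end-ext extI

  ordinal-in-cut : ∀ {x} → I x → IsOrd 𝓜 x → OrdOf 𝓜 I x
  ordinal-in-cut x∈I ord-x =
    x∈I , (λ y y∈x z z∈y → proj₁ ord-x (proj₁ y) y∈x (proj₁ z) z∈y)
        , (λ y y∈x z z∈y w w∈z → proj₂ ord-x (proj₁ y) y∈x (proj₁ z) z∈y (proj₁ w) w∈z)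

  element-outside-cut : ∀ {κ} → IsOrd 𝓜 κ → ¬ OrdOf 𝓜 I κ → Σ M λ α → α ∈ κ × ¬ OrdOf 𝓜 I α
  element-outside-cut ord-κ κ∉I = dne λ none →
    κ∉I (ordinal-in-cut (ordinals-in-cut _ λ x x∈κ → dne λ x∉I → none (x , x∈κ , x∉I)) ord-κ)

  -- The cover is P(P(a ∪ b)) computed in I.
  pair-cover : ∀ {a b} → I a → I b → Σ M λ Q → I Q × (∀ p x y → x ∈ a → y ∈ b → IsPair₀ p x y → p ∈ Q)
  pair-cover {a} {b} a∈I b∈I = proj₁ (proj₁ PPu) , proj₂ (proj₁ PPu) , pair∈PPu
    where
    ab : Σ (Σ M I) λ c → a ∈ proj₁ c × b ∈ proj₁ c
    ab = pairI (a , a∈I) (b , b∈I)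
    U : Σ (Σ M I) λ u → ∀ t → (proj₁ t ∈ proj₁ u → Σ (Σ M I) λ x → proj₁ x ∈ proj₁ (proj₁ ab) × proj₁ t ∈ proj₁ x)
                           × ((Σ (Σ M I) λ x → proj₁ x ∈ proj₁ (proj₁ ab) × proj₁ t ∈ proj₁ x) → proj₁ t ∈ proj₁ u)
    U = unionI (proj₁ ab)
    u : M
    u = proj₁ (proj₁ U)
    a∪b⊆u : ∀ t → t ∈ a ⊎ t ∈ b → t ∈ u
    a∪b⊆u t (inj₁ t∈a) = proj₂ (proj₂ U (t , end-ext a t a∈I t∈a)) ((a , a∈I) , proj₁ (proj₂ ab) , t∈a)
    a∪b⊆u t (inj₂ t∈b) = proj₂ (proj₂ U (t , end-ext b t b∈I t∈b)) ((b , b∈I) , proj₂ (proj₂ ab) , t∈b)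
    Pu : Σ (Σ M I) λ P → ∀ s → (proj₁ s ∈ proj₁ P → _⊆_ (Substr 𝓜 I) s (proj₁ U)) × (_⊆_ (Substr 𝓜 I) s (proj₁ U) → proj₁ s ∈ proj₁ P)
    Pu = powI (proj₁ U)
    PPu : Σ (Σ M I) λ P → ∀ s → (proj₁ s ∈ proj₁ P → _⊆_ (Substr 𝓜 I) s (proj₁ Pu)) × (_⊆_ (Substr 𝓜 I) s (proj₁ Pu) → proj₁ s ∈ proj₁ P)
    PPu = powI (proj₁ Pu)
    ⊆u⇒∈Pu : ∀ s → _⊆_ 𝓜 s u → I s × s ∈ proj₁ (proj₁ Pu)
    ⊆u⇒∈Pu s s⊆u = s∈I , proj₂ (proj₂ Pu (s , s∈I)) λ t t∈s → s⊆u (proj₁ t) t∈s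
      where
      s∈I : I s
      s∈I = ⊆-in-cut s u (proj₂ (proj₁ U)) s⊆u
    pair∈PPu : ∀ p x y → x ∈ a → y ∈ b → IsPair₀ p x y → p ∈ proj₁ (proj₁ PPu)
    pair∈PPu p x y x∈a y∈b P = proj₂ (proj₂ PPu (p , p∈I)) λ s s∈p → proj₂ (⊆u⇒∈Pu (proj₁ s) (member⊆u (proj₁ s) s∈p))
      where
      member⊆u : ∀ s → s ∈ p → _⊆_ 𝓜 s u
      member⊆u s s∈p t t∈s = a∪b⊆u t ([ (λ { refl → inj₁ x∈a }) , (λ { refl → inj₂ y∈b }) ]′ (pair-elements P s s∈p t t∈s))
      p∈I : I p
      p∈I = ⊆-in-cut p (proj₁ (proj₁ Pu)) (proj₂ (proj₁ Pu)) λ s s∈p → proj₂ (⊆u⇒∈Pu s (member⊆u s s∈p))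

  module _ {k α f} (k∈I : I k) (ord-α : IsOrd 𝓜 α) (f-bij : IsBij₀ f k α) where
    open Bij₀ f-bij

    k² : Σ M λ Q → I Q × (∀ p x y → x ∈ k → y ∈ k → IsPair₀ p x y → p ∈ Q)
    k² = pair-cover k∈I k∈I

    Below : M → Set
    Below q = Σ M λ y → y ∈ k × (Σ M λ x → x ∈ k × (IsPair₀ q y x
      × (Σ M λ u → u ∈ α × (Σ M λ u' → u' ∈ α × (Rel₀ f y u × (Rel₀ f x u' × u ∈ u'))))))

    R-set : Σ M λ R → ∀ q → (q ∈ R → q ∈ proj₁ k² × Below q) × (q ∈ proj₁ k² × Below q → q ∈ R)
    R-set = Δ0sep (Ex∈ 1 (Ex∈ 2 (PairF 2 1 0 ∧' Ex∈ 5 (Ex∈ 6 (RelF 6 3 1 ∧' (RelF 6 2 0 ∧' (1 ∈' 0)))))))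
                  (b∃ 1 (b∃ 2 (cnj (PairF-Δ0 _ _ _) (b∃ 5 (b∃ 6 (cnj (RelF-Δ0 _ _ _) (cnj (RelF-Δ0 _ _ _) (at∈ _ _))))))))
                  (k ∷ f ∷ α ∷ const α) (proj₁ k²)

    R : M
    R = proj₁ R-set

    R∈I : I R
    R∈I = ⊆-in-cut R (proj₁ k²) (proj₁ (proj₂ k²)) λ q q∈R → proj₁ (proj₁ (proj₂ R-set q) q∈R)

    R⇒∈ : ∀ {y x} → Rel₀ R y x → y ∈ k × (x ∈ k × (∀ u u' → Rel₀ f y u → Rel₀ f x u' → u ∈ u'))
    R⇒∈ (q , q∈R , P) with proj₂ (proj₁ (proj₂ R-set q) q∈R)
    ... | _ , y∈k , _ , x∈k , P' , _ , _ , _ , _ , fyu , fxu' , u∈u' with pair-injective P P'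
    ... | refl , refl = y∈k , x∈k , λ v v' fyv fxv' → subst₂ _∈_ (functional fyu fyv) (functional fxu' fxv') u∈u'

    ∈⇒R : ∀ {y x u u'} → y ∈ k → x ∈ k → Rel₀ f y u → Rel₀ f x u' → u ∈ u' → Rel₀ R y x
    ∈⇒R {y} {x} {u} {u'} y∈k x∈k fyu fxu' u∈u' with pair y x
    ... | q , P = q , proj₂ (proj₂ R-set q) (proj₂ (proj₂ k²) q y x y∈k x∈k P
                    , y , y∈k , x , x∈k , P , u , proj₂ (rel-∈ fyu) , u' , proj₂ (rel-∈ fxu') , fyu , fxu' , u∈u') , P

    open Collapse f-bij ord-α R⇒∈ ∈⇒R

    CollapseValue : Fm
    CollapseValue = PartialCollapseF 0 2 3 4 ∧' ImageBelowF 0 2 1 3 4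

    CollapseValue-Δ0 : IsΔ0 CollapseValue
    CollapseValue-Δ0 = cnj (PartialCollapseF-Δ0 0 2 3 4) (ImageBelowF-Δ0 0 2 1 3 4)

    ρ : Env N
    ρ = _∷ₑ_ N (k , k∈I) (_∷ₑ_ N (R , R∈I) (const (k , k∈I)))

    -- G = { t ∈ k ∣ the collapse of (k , R) is defined at t }, separated inside I;
    -- by uniqueness of the collapse in 𝓜 its value there is f t.
    G-set : Σ (Σ M I) λ G → ∀ t → (proj₁ t ∈ proj₁ G → proj₁ t ∈ k × Sat N (_∷ₑ_ N t ρ) (∃' (∃' CollapseValue)))
                                × (proj₁ t ∈ k × Sat N (_∷ₑ_ N t ρ) (∃' (∃' CollapseValue)) → proj₁ t ∈ proj₁ G)
    G-set = Σ1sepI (∃' (∃' CollapseValue)) (ex (ex (δ0 CollapseValue-Δ0))) ρ (k , k∈I)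

    G : M
    G = proj₁ (proj₁ G-set)

    collapsible⇒image-in-cut : ∀ t → t ∈ G → Σ M λ v → I v × Rel₀ f t v
    collapsible⇒image-in-cut t t∈G =
      let (t∈k , v , sat) = proj₁ (proj₂ G-set t′) t∈G
          (g , g-coll , img) = Σ1-upward (ex (δ0 CollapseValue-Δ0)) (_∷ₑ_ N v (_∷ₑ_ N t′ ρ)) sat
      in proj₁ v , proj₂ v , collapse-unique t∈k g-coll img
      where
      t′ : Σ M I
      t′ = t , end-ext G t (proj₂ (proj₁ G-set)) t∈G

    image-in-cut⇒collapsible : ∀ {a w} → a ∈ k → Rel₀ f a w → I w → a ∈ G
    image-in-cut⇒collapsible {a} {w} a∈k faw w∈I =
      proj₂ (proj₂ G-set a′) (a∈k , (w , w∈I) , (g , g∈I) , proj₂ (Δ0-absolute CollapseValue-Δ0 ρ′) (g-coll , img))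
      where
      a′ : Σ M I
      a′ = a , end-ext k a k∈I a∈k
      restriction : Σ M λ g → PartialCollapse g a k R × (IsImageBelow g a w k R
        × (∀ p → p ∈ g → Σ M λ x → Σ M λ u → IsPair₀ p x u × (x ∈ k × u ∈ w)))
      restriction = restriction-below a∈k faw
      g : M
      g = proj₁ restriction
      g-coll : PartialCollapse g a k R
      g-coll = proj₁ (proj₂ restriction)
      img : IsImageBelow g a w k R
      img = proj₁ (proj₂ (proj₂ restriction))
      g∈I : I g
      g∈I = let (Q , Q∈I , pairs∈Q) = pair-cover k∈I w∈I in ⊆-in-cut g Q Q∈I λ p p∈g →
        let (x , u , P , x∈k , u∈w) = proj₂ (proj₂ (proj₂ restriction)) p p∈g in pairs∈Q p x u x∈k u∈w P
      ρ′ : Env N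
      ρ′ = _∷ₑ_ N (g , g∈I) (_∷ₑ_ N (w , w∈I) (_∷ₑ_ N a′ ρ))

    f[G] : Σ M λ β → ∀ z → (z ∈ β → z ∈ α × (Σ M λ x → x ∈ G × Rel₀ f x z)) × (z ∈ α × (Σ M λ x → x ∈ G × Rel₀ f x z) → z ∈ β)
    f[G] = Δ0sep (Ex∈ 1 (RelF 3 0 1)) (b∃ 1 (RelF-Δ0 3 0 1)) (G ∷ f ∷ const f) α

    β : M
    β = proj₁ f[G]

    β∈I : I β
    β∈I = ordinals-in-cut β λ z z∈β →
      let (z∈α , x , x∈G , fxz) = proj₁ (proj₂ f[G] z) z∈β
          (v , v∈I , fxv) = collapsible⇒image-in-cut x x∈G
      in ordinal-in-cut (subst I (functional fxv fxz) v∈I) (ordinal-element ord-α z∈α)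

    α⊆β : ∀ z → z ∈ α → z ∈ β
    α⊆β = ∈-induction (_∈ β) (proj₁ ord-α) (λ z → proj₁ (proj₂ α∖β z)) (λ z z∈α z∉β → proj₂ (proj₂ α∖β z) (z∈α , z∉β)) step
      where
      α∖β : Σ M λ D → ∀ z → (z ∈ D → z ∈ α × ¬ z ∈ β) × (z ∈ α × ¬ z ∈ β → z ∈ D)
      α∖β = Δ0sep ((0 ∈' 1) ⇒ ⊥') (imp (at∈ 0 1) bot) (β ∷ const β) α
      step : ∀ z → z ∈ α → (∀ v → v ∈ z → v ∈ β) → z ∈ β
      step z z∈α z⊆β =
        let (a , a∈k , faz) = surjective z z∈α
        in proj₂ (proj₂ f[G] z) (z∈α , a , image-in-cut⇒collapsible a∈k faz (⊆-in-cut z β β∈I z⊆β) , faz)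

    equinumerous-ordinal-in-cut : I α
    equinumerous-ordinal-in-cut = ⊆-in-cut α β β∈I α⊆β

lemma4p3 : ExcludedMiddle 0ℓ →
    (𝓜 : Str) → Countable 𝓜 → ⊨MOST 𝓜 → Δ0P-Collection 𝓜 →
    (I : Str.M 𝓜 → Set) → HCut 𝓜 I →
    ¬ (Σ (Str.M 𝓜) λ κ →
         (IsCard 𝓜 κ × ¬ OrdOf 𝓜 I κ)
       × (∀ μ → IsCard 𝓜 μ × ¬ OrdOf 𝓜 I μ → Str._∈_ 𝓜 κ μ ⊎ κ ≡ μ))
lemma4p3 em 𝓜 _ most _ I hcut (κ , (card-κ , κ∉I) , κ-least) =
  let (α , α∈κ , α∉I) = element-outside-cut ord-κ κ∉I
      ord-α = ordinal-element ord-κ α∈κ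
      (k , k∈α , card-k , f , f-bij) = cardinality Σ1sep ord-α (α∉I ∘ cardinal-below-κ-in-cut α∈κ)
      k∈I = proj₁ (cardinal-below-κ-in-cut (proj₁ ord-κ α α∈κ k k∈α) card-k)
  in α∉I (ordinal-in-cut (equinumerous-ordinal-in-cut k∈I ord-α f-bij) ord-α)
  where
  dne : DoubleNegationElimination 0ℓ
  dne = em⇒dne em
  open Str 𝓜
  open ⊨MOST most using (mac; Σ1sep)
  open Elementary 𝓜 dne mac
  open Cut 𝓜 dne mac I hcut
  ord-κ : IsOrd 𝓜 κ
  ord-κ = proj₁ card-κ
  cardinal-below-κ-in-cut : ∀ {μ} → μ ∈ κ → IsCard 𝓜 μ → OrdOf 𝓜 I μ
  cardinal-below-κ-in-cut {μ} μ∈κ card-μ = dne λ μ∉I →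
    [ (λ κ∈μ → ∈-irrefl κ (proj₁ ord-κ μ μ∈κ κ κ∈μ)) , (λ { refl → ∈-irrefl κ μ∈κ }) ]′ (κ-least μ (card-μ , μ∉I))
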